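{- Let $r\geq 2$ be an integer and $t:=v(r-1)$. For all integers $3\leq n\leq r$, $v\left(\binom{r}{n}\right)+n\geq t+2$.
   Context: $v$ is the $2$-adic valuation on $\mathbb{Q}$ with $v(2)=1$. -}

module Defs where

open import Data.Nat using (ℕ; suc; _^_)
open import Data.Nat.Divisibility using (_∣_)
open import Data.Product using (_×_)
open import Relation.Nullary using (¬_)

-- 2-adic valuation as a relation: Val₂ m k  means  v₂(m) = k,
-- i.e. 2^k divides m but 2^(k+1) does not.  For m > 0 such k exists
-- and is unique, so this is the graph of v₂ on positive integers.
Val₂ : ℕ → ℕ → Set
Val₂ m k = (2 ^ k ∣ m) × ¬ (2 ^ suc k ∣ m)

-- Absorbing twice, n (n-1) C(r,n) = r (r-1) C(r-2,n-2), so 2^t ∣ r - 1 divides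
-- n (n-1) C(r,n).  One of n, n-1 is odd and cancels, leaving 2^t ∣ w C(r,n) with
-- w ≤ n, hence 2^(t ∸ b) ∣ w for b = v(C(r,n)).  So 2^(t ∸ b) ≤ n, and for n ≥ 3
-- this forces (t ∸ b) + 2 ≤ n.
module Submission where

open import Defs
open import Data.Nat using (ℕ; _+_; _∸_; _≤_; _≥_; zero; suc; _*_; _^_; s≤s; z<s; NonZero)
open import Data.Nat.Combinatorics using (_C_; nC1≡n; nCk+nC[k+1]≡[n+1]C[k+1])
open import Algebra.Properties.CommutativeSemigroup using (x∙yz≈y∙xz)
open import Data.Nat.Divisibility
open import Data.Nat.Primality using (Prime; prime?; euclidsLemma; prime⇒nonZero)
open import Data.Nat.Properties
open import Data.Product using (∃-syntax; _×_; _,_)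
open import Data.Sum using (_⊎_; inj₁; inj₂)
open import Relation.Binary.PropositionalEquality
open import Relation.Nullary using (¬_; yes; no; contradiction)
open import Relation.Nullary.Decidable using (from-yes)

[k+1]*[n+1]C[k+1]≡[n+1]*nCk : ∀ n k → suc k * (suc n C suc k) ≡ suc n * (n C k)
[k+1]*[n+1]C[k+1]≡[n+1]*nCk zero zero = refl
[k+1]*[n+1]C[k+1]≡[n+1]*nCk zero (suc k) = *-zeroʳ (suc (suc k))
[k+1]*[n+1]C[k+1]≡[n+1]*nCk (suc n) zero =
  trans (*-identityˡ _) (trans (nC1≡n (suc (suc n))) (sym (*-identityʳ _)))
[k+1]*[n+1]C[k+1]≡[n+1]*nCk (suc n) (suc k) = begin
  suc (suc k) * (suc (suc n) C suc (suc k))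
    ≡⟨ cong (suc (suc k) *_) (nCk+nC[k+1]≡[n+1]C[k+1] (suc n) (suc k)) ⟨
  suc (suc k) * (A + B)
    ≡⟨ *-distribˡ-+ (suc (suc k)) A B ⟩
  (A + suc k * A) + suc (suc k) * B
    ≡⟨ +-assoc A (suc k * A) (suc (suc k) * B) ⟩
  A + (suc k * A + suc (suc k) * B)
    ≡⟨ cong₂ (λ x y → A + (x + y)) ([k+1]*[n+1]C[k+1]≡[n+1]*nCk n k)
                                   ([k+1]*[n+1]C[k+1]≡[n+1]*nCk n (suc k)) ⟩
  A + (suc n * (n C k) + suc n * (n C suc k))
    ≡⟨ cong (A +_) (*-distribˡ-+ (suc n) (n C k) (n C suc k)) ⟨
  A + suc n * (n C k + n C suc k)
    ≡⟨ cong (λ x → A + suc n * x) (nCk+nC[k+1]≡[n+1]C[k+1] n k) ⟩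
  A + suc n * A
    ∎
  where
  open ≡-Reasoning
  A = suc n C suc k
  B = suc n C suc (suc k)

[k+2]*[k+1]*[n+2]C[k+2]≡[n+2]*[n+1]*nCk :
  ∀ n k → suc (suc k) * (suc k * (suc (suc n) C suc (suc k)))
        ≡ suc (suc n) * (suc n * (n C k))
[k+2]*[k+1]*[n+2]C[k+2]≡[n+2]*[n+1]*nCk n k = begin
  suc (suc k) * (suc k * (suc (suc n) C suc (suc k)))
    ≡⟨ x∙yz≈y∙xz *-commutativeSemigroup (suc (suc k)) (suc k) (suc (suc n) C suc (suc k)) ⟩
  suc k * (suc (suc k) * (suc (suc n) C suc (suc k)))
    ≡⟨ cong (suc k *_) ([k+1]*[n+1]C[k+1]≡[n+1]*nCk (suc n) (suc k)) ⟩
  suc k * (suc (suc n) * (suc n C suc k))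
    ≡⟨ x∙yz≈y∙xz *-commutativeSemigroup (suc k) (suc (suc n)) (suc n C suc k) ⟩
  suc (suc n) * (suc k * (suc n C suc k))
    ≡⟨ cong (suc (suc n) *_) ([k+1]*[n+1]C[k+1]≡[n+1]*nCk n k) ⟩
  suc (suc n) * (suc n * (n C k))
    ∎
  where open ≡-Reasoning

2-prime : Prime 2
2-prime = from-yes (prime? 2)

2∤1 : ¬ 2 ∣ 1
2∤1 2∣1 with () ← ∣1⇒≡1 2∣1

¬2∣n⊎¬2∣1+n : ∀ n → ¬ 2 ∣ n ⊎ ¬ 2 ∣ suc n
¬2∣n⊎¬2∣1+n n with 2 ∣? n
... | no 2∤n  = inj₁ 2∤n
... | yes 2∣n = inj₂ λ 2∣1+n →
  2∤1 (∣m+n∣m⇒∣n (subst (2 ∣_) (+-comm 1 n) 2∣1+n) 2∣n)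

p^t∣o*x⇒p^t∣x : ∀ {p o x} t → Prime p → ¬ p ∣ o → p ^ t ∣ o * x → p ^ t ∣ x
p^t∣o*x⇒p^t∣x zero _ _ _ = 1∣ _
p^t∣o*x⇒p^t∣x {p} {o} {x} (suc t) p-prime p∤o p^[1+t]∣o*x
  with euclidsLemma o x p-prime (∣-trans (m∣m*n (p ^ t)) p^[1+t]∣o*x)
... | inj₁ p∣o = contradiction p∣o p∤o
... | inj₂ (divides q refl) = subst (_∣ q * p) (*-comm (p ^ t) p) (*-monoˡ-∣ p p^t∣q)
  where
  o*[q*p]≡p*[o*q] : o * (q * p) ≡ p * (o * q)
  o*[q*p]≡p*[o*q] = trans (cong (o *_) (*-comm q p)) (x∙yz≈y∙xz *-commutativeSemigroup o p q)
  p^t∣q : p ^ t ∣ q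
  p^t∣q = p^t∣o*x⇒p^t∣x t p-prime p∤o
    (*-cancelˡ-∣ p {{prime⇒nonZero p-prime}} (subst (p ^ suc t ∣_) o*[q*p]≡p*[o*q] p^[1+t]∣o*x))

p^t∣w*p^b⇒p^[t∸b]∣w : ∀ {w} p t b .{{_ : NonZero p}} → p ^ t ∣ w * p ^ b → p ^ (t ∸ b) ∣ w
p^t∣w*p^b⇒p^[t∸b]∣w {w} p t b p^t∣w*p^b with b ≤? t
... | no  b≰t = subst (λ e → p ^ e ∣ w) (sym (m≤n⇒m∸n≡0 (≰⇒≥ b≰t))) (1∣ w)
... | yes b≤t = *-cancelʳ-∣ (p ^ b) {{m^n≢0 p b}} (subst (_∣ w * p ^ b) p^t≡p^[t∸b]*p^b p^t∣w*p^b)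
  where
  p^t≡p^[t∸b]*p^b : p ^ t ≡ p ^ (t ∸ b) * p ^ b
  p^t≡p^[t∸b]*p^b = trans (cong (p ^_) (sym (m∸n+n≡m b≤t))) (^-distribˡ-+-* p (t ∸ b) b)

Val₂⇒≡odd*2^ : ∀ {m} b → Val₂ m b → ∃[ q ] ¬ 2 ∣ q × m ≡ q * 2 ^ b
Val₂⇒≡odd*2^ b (divides q m≡q*2^b , 2^[1+b]∤m) =
  q , (λ 2∣q → 2^[1+b]∤m (subst (2 ^ suc b ∣_) (sym m≡q*2^b) (*-monoˡ-∣ (2 ^ b) 2∣q))) , m≡q*2^b

2^t∣w*c⇒2^[t∸b]∣w : ∀ {w c t} b → Val₂ c b → 2 ^ t ∣ w * c → 2 ^ (t ∸ b) ∣ w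
2^t∣w*c⇒2^[t∸b]∣w {w} {c} {t} b c-val 2^t∣w*c with Val₂⇒≡odd*2^ b c-val
... | q , 2∤q , refl = p^t∣w*p^b⇒p^[t∸b]∣w 2 t b (p^t∣o*x⇒p^t∣x t 2-prime 2∤q
        (subst (2 ^ t ∣_) (x∙yz≈y∙xz *-commutativeSemigroup w q (2 ^ b)) 2^t∣w*c))

[n+2]+2≤2^[n+2] : ∀ n → suc (suc n) + 2 ≤ 2 ^ suc (suc n)
[n+2]+2≤2^[n+2] zero    = ≤-refl
[n+2]+2≤2^[n+2] (suc n) = begin
  suc (suc (suc n) + 2)
    ≤⟨ m<m+n (suc (suc n) + 2) z<s ⟩
  (suc (suc n) + 2) + (suc (suc n) + 2)
    ≤⟨ +-mono-≤ ([n+2]+2≤2^[n+2] n) ([n+2]+2≤2^[n+2] n) ⟩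
  2 ^ suc (suc n) + 2 ^ suc (suc n)
    ≡⟨ cong (2 ^ suc (suc n) +_) (+-identityʳ _) ⟨
  2 ^ suc (suc (suc n))
    ∎
  where open ≤-Reasoning

2^e≤n⇒e+2≤n : ∀ {n} e → 3 ≤ n → 2 ^ e ≤ n → e + 2 ≤ n
2^e≤n⇒e+2≤n zero          3≤n _     = ≤-trans (n≤1+n 2) 3≤n
2^e≤n⇒e+2≤n (suc zero)    3≤n _     = 3≤n
2^e≤n⇒e+2≤n (suc (suc e)) _   2^e≤n = ≤-trans ([n+2]+2≤2^[n+2] e) 2^e≤n

2^t∣[m+2]*[m+1]*c⇒2^[t∸b]≤m+2 : ∀ {c t} m b → Val₂ c b →
  2 ^ t ∣ suc (suc m) * (suc m * c) → 2 ^ (t ∸ b) ≤ suc (suc m)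
2^t∣[m+2]*[m+1]*c⇒2^[t∸b]≤m+2 {c} {t} m b c-val 2^t∣[m+2]*[m+1]*c with ¬2∣n⊎¬2∣1+n (suc m)
... | inj₁ 2∤m+1 = ∣⇒≤ (2^t∣w*c⇒2^[t∸b]∣w b c-val (p^t∣o*x⇒p^t∣x t 2-prime 2∤m+1
        (subst (2 ^ t ∣_) (x∙yz≈y∙xz *-commutativeSemigroup (suc (suc m)) (suc m) c) 2^t∣[m+2]*[m+1]*c)))
... | inj₂ 2∤m+2 = ≤-trans
        (∣⇒≤ (2^t∣w*c⇒2^[t∸b]∣w b c-val (p^t∣o*x⇒p^t∣x t 2-prime 2∤m+2 2^t∣[m+2]*[m+1]*c)))
        (n≤1+n (suc m))

lemma3p3 : (r : ℕ) → r ≥ 2 → (t : ℕ) → Val₂ (r ∸ 1) t →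
           (n : ℕ) → 3 ≤ n → n ≤ r →
           (b : ℕ) → Val₂ (r C n) b →
           b + n ≥ t + 2
lemma3p3 (suc zero) (s≤s ()) _ _ _ _ _ _ _
lemma3p3 _ _ _ _ (suc zero) (s≤s ()) _ _ _
lemma3p3 (suc (suc r)) _ t (2^t∣r+1 , _) (suc (suc k)) 3≤n _ b c-val = begin
  t + 2                   ≤⟨ +-monoˡ-≤ 2 (m≤n+m∸n t b) ⟩
  b + (t ∸ b) + 2         ≡⟨ +-assoc b (t ∸ b) 2 ⟩
  b + ((t ∸ b) + 2)       ≤⟨ +-monoʳ-≤ b (2^e≤n⇒e+2≤n (t ∸ b) 3≤n 2^[t∸b]≤n) ⟩
  b + suc (suc k)         ∎
  where
  open ≤-Reasoning
  2^t∣n*[n-1]*c : 2 ^ t ∣ suc (suc k) * (suc k * (suc (suc r) C suc (suc k)))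
  2^t∣n*[n-1]*c = subst (2 ^ t ∣_) (sym ([k+2]*[k+1]*[n+2]C[k+2]≡[n+2]*[n+1]*nCk r k))
    (∣-trans 2^t∣r+1 (∣-trans (m∣m*n (r C k)) (n∣m*n (suc (suc r)))))
  2^[t∸b]≤n : 2 ^ (t ∸ b) ≤ suc (suc k)
  2^[t∸b]≤n = 2^t∣[m+2]*[m+1]*c⇒2^[t∸b]≤m+2 k b c-val 2^t∣n*[n-1]*c
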